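{- Let $n \geq 1$, let $\Pi \subseteq S_n$ be admissible and shift restricted, let $m > n$, and suppose the word graph $G_m = G_m(\Pi)$ is alphabet stable and subregular. Then $\mathrm{Aut}(G_m) \cong S_m$.
   Context: Word graphs: for $\Pi \subseteq S_n$, $m > n$ and a set $B$ with $|B| = m$, the word graph $G_m = G_m(\Pi)$ is the directed graph whose vertices are the words $x_1 \dots x_n$ over $B$ with pairwise distinct letters, with arcs $x_1 x_2 \dots x_n \to x_2 \dots x_n y$ for every $y \in B\setminus\{x_1,\dots,x_n\}$ and $x_1 \dots x_n \to x_{\pi(1)} \dots x_{\pi(n)}$ for every $\pi \in \Pi$. $\Pi$ is admissible if the directed diameter of $G_{4n}(\Pi)$ equals $n$; $\Pi$ is shift restricted if $\pi(i) \leq i+1$ for all $\pi \in \Pi$, $1 \leq i \leq n$. The alphabet of a vertex $v = x_1\dots x_n$ is $\alpha(v) = \{x_1,\dots,x_n\}$. $G_m$ is alphabet stable if there is no automorphism $\phi$ of $G_m$ and vertices $u, v$ with $\alpha(u) = \alpha(v)$ but $\alpha(\phi(u)) \neq \alpha(\phi(v))$. The alphabet fixing subgraph $\Gamma_n$ is the subgraph of $G_m$ induced by the vertices whose alphabet is a fixed $n$-element subset $A \subseteq B$ (its arcs are exactly the arcs $x_1\dots x_n \to x_{\pi(1)}\dots x_{\pi(n)}$, $\pi\in\Pi$; it is independent of $A$ up to isomorphism and is isomorphic to the Cayley digraph of $S_n$ with connection set $\Pi$). $G_m$ is subregular if $\mathrm{Aut}(\Gamma_n) \cong S_n$, i.e.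 the only automorphisms of $\Gamma_n$ are the $n!$ maps induced by permuting the letters of $A$. -}

module Defs where

open import Data.Nat using (ℕ; zero; suc; _≤_; _<_; _*_)
open import Data.Fin using (Fin; toℕ)
open import Data.Fin.Permutation using (Permutation′; _⟨$⟩ʳ_; _∘ₚ_)
open import Data.Vec using (Vec; []; _∷_; _∷ʳ_; tabulate; lookup; map)
open import Data.Vec.Membership.Propositional using (_∈_)
open import Data.Bool using (Bool; true; false; _∧_; not; T)
open import Data.List using (List)
open import Data.List.Relation.Unary.Any using (Any)
open import Data.List.Relation.Unary.All using (All)
open import Data.Product using (Σ; ∃; ∃-syntax; _×_; _,_; proj₁)
open import Data.Sum using (_⊎_)
open import Relation.Nullary using (¬_; does)
open import Relation.Binary.PropositionalEquality using (_≡_)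
import Data.Fin as F

occurs : ∀ {m k} → Fin m → Vec (Fin m) k → Bool
occurs a []       = false
occurs a (x ∷ xs) = does (a F.≟ x) Data.Bool.∨ occurs a xs
  where import Data.Bool

distinct : ∀ {m k} → Vec (Fin m) k → Bool
distinct []       = true
distinct (x ∷ xs) = not (occurs x xs) ∧ distinct xs

-- Vertices of the word graph G_m (words of length n over B = Fin m,
-- pairwise distinct letters).  T b is proof-irrelevant.
Vertex : ℕ → ℕ → Set
Vertex m n = Σ (Vec (Fin m) n) (λ w → T (distinct w))

word : ∀ {m n} → Vertex m n → Vec (Fin m) n
word = proj₁

shift : ∀ {A : Set} {n} → Vec A n → A → Vec A n
shift []       y = []
shift (x ∷ xs) y = xs ∷ʳ y

permuteWord : ∀ {A : Set} {n} → Permutation′ n → Vec A n → Vec A n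
permuteWord π w = tabulate (λ i → lookup w (π ⟨$⟩ʳ i))

Arc : ∀ {n} (m : ℕ) → List (Permutation′ n) → Vertex m n → Vertex m n → Set
Arc m Π u v =
  (∃[ y ] (¬ (y ∈ word u) × word v ≡ shift (word u) y))
  ⊎ Any (λ π → word v ≡ permuteWord π (word u)) Π

data Walk {n} (m : ℕ) (Π : List (Permutation′ n)) :
          Vertex m n → Vertex m n → ℕ → Set where
  here : ∀ {u} → Walk m Π u u zero
  step : ∀ {u v w k} → Arc m Π u v → Walk m Π v w k → Walk m Π u w (suc k)

DiameterEq : ∀ {n} (m : ℕ) → List (Permutation′ n) → ℕ → Set
DiameterEq {n} m Π d =
  ((u v : Vertex m n) → ∃[ k ] (k ≤ d × Walk m Π u v k))
  × (∃[ u ] ∃[ v ] ((k : ℕ) → Walk m Π u v k → d ≤ k))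

Admissible : ∀ n → List (Permutation′ n) → Set
Admissible n Π = DiameterEq (4 * n) Π n

ShiftRestricted : ∀ n → List (Permutation′ n) → Set
ShiftRestricted n Π = All (λ π → ∀ i → toℕ (π ⟨$⟩ʳ i) ≤ suc (toℕ i)) Π

record Automorphism (V : Set) (E : V → V → Set) : Set where
  field
    to      : V → V
    from    : V → V
    to∘from : ∀ v → to (from v) ≡ v
    from∘to : ∀ v → from (to v) ≡ v
    preserve : ∀ u v → E u v → E (to u) (to v)
    reflect  : ∀ u v → E (to u) (to v) → E u v
open Automorphism public

AutG : ∀ {n} (m : ℕ) → List (Permutation′ n) → Set
AutG {n} m Π = Automorphism (Vertex m n) (Arc m Π)

SameAlphabet : ∀ {m n} → Vertex m n → Vertex m n → Set
SameAlphabet u v = ∀ a → (a ∈ word u → a ∈ word v) × (a ∈ word v → a ∈ word u)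

AlphabetStable : ∀ {n} (m : ℕ) → List (Permutation′ n) → Set
AlphabetStable {n} m Π =
  ¬ (∃[ φ ] ∃[ u ] ∃[ v ]
       (SameAlphabet {m} {n} u v × ¬ SameAlphabet (to {E = Arc m Π} φ u) (to φ v)))

-- The alphabet fixing subgraph Γ_n (alphabet A taken to be Fin n)

GammaArc : ∀ {n} → List (Permutation′ n) → Vertex n n → Vertex n n → Set
GammaArc Π u v = Any (λ π → word v ≡ permuteWord π (word u)) Π

Subregular : ∀ n → List (Permutation′ n) → Set
Subregular n Π =
  (φ : Automorphism (Vertex n n) (GammaArc Π)) →
  ∃[ σ ] ((v : Vertex n n) → word (to φ v) ≡ map (σ ⟨$⟩ʳ_) (word v))

-- Aut(G_m) ≅ S_m : a group isomorphism from S_m (Permutation′ m,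
-- composition (σ ∘ τ)(i) = σ(τ(i)), written τ ∘ₚ σ in the stdlib)
-- to Aut(G_m) (composition of maps), both with extensional equality.

AutIsoSym : ∀ {n} (m : ℕ) → List (Permutation′ n) → Set
AutIsoSym {n} m Π =
  Σ (Permutation′ m → AutG m Π) λ Φ →
    ( (∀ (σ τ : Permutation′ m) (v : Vertex m n) →
         to {E = Arc m Π} (Φ (τ ∘ₚ σ)) v ≡ to (Φ σ) (to (Φ τ) v))
    × (∀ (σ τ : Permutation′ m) →
         (∀ v → to {E = Arc m Π} (Φ σ) v ≡ to (Φ τ) v) →
         ∀ i → σ ⟨$⟩ʳ i ≡ τ ⟨$⟩ʳ i)
    × (∀ (φ : AutG m Π) → ∃[ σ ] (∀ v → to (Φ σ) v ≡ to φ v)) )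

module Submission where

-- Relabelling words by a permutation σ of the m letters is an automorphism
-- of G_m, and σ ↦ (relabelling by σ) is a faithful homomorphism.  The work
-- is to show that every automorphism φ is such a relabelling.
--
--  1. Alphabet stability (a decidable property, hence usable
--     constructively) says that φ and φ⁻¹ preserve "same alphabet".
--     Permutation arcs join words of one alphabet and shift arcs never do,
--     so φ maps arcs of each kind to arcs of the same kind.
--  2. The words with the alphabet of w are the reindexings w∘t with t a
--     vertex of Γ_n.  Conjugating by φ gives an automorphism of Γ_n, which
--     by subregularity permutes letters; it fixes the identity word, so it
--     is trivial: φ(w∘t) = φ(w)∘t.  Thus on every alphabet class φ acts
--     through one map of letters.
--  3. A shift arc keeps n - 1 letters, so these local letter maps agree
--     across a single letter exchange; chaining exchanges, they agree on
--     all vertices and define one permutation σ with φ = relabelling by σ.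

open import Defs
open import Data.Nat using (ℕ; zero; suc; _≤_; _<_; z≤n; s≤s)
open import Data.Nat.Properties using (<⇒≤; 1+n≰n)
open import Data.Fin as F using (Fin; inject₁; inject≤; punchOut)
open import Data.Fin.Properties
  using (suc-injective; 0≢1+n; any?; all?; ¬∀⟶∃¬; injective⇒≤; punchOut-injective; inject≤-injective)
open import Data.Fin.Permutation
  using (Permutation′; _⟨$⟩ʳ_; _⟨$⟩ˡ_; _∘ₚ_; inverseˡ; inverseʳ; permutation; transpose)
import Data.Fin.Permutation as Perm
open import Data.Vec using (Vec; []; _∷_; _∷ʳ_; tabulate; lookup; map)
open import Data.Vec.Properties using (lookup∘tabulate; tabulate∘lookup; tabulate-cong; lookup-map; map-∘; map-∷ʳ)
open import Data.Vec.Membership.Propositional using (_∈_; _∉_)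
open import Data.Vec.Membership.Propositional.Properties using (∈-lookup)
open import Data.Vec.Relation.Unary.Any using (here; there; index)
open import Data.Vec.Relation.Unary.Any.Properties using (lookup-index)
open import Data.List using (List; []; _∷_; allFin)
import Data.List.Relation.Unary.Any as ListAny
open import Data.List.Membership.Propositional using () renaming (_∉_ to _∉ₗ_)
open import Data.List.Membership.Propositional.Properties using (∈-allFin)
open import Data.Bool using (Bool; true; false; T; not)
open import Data.Bool.Properties using (T-irrelevant; T-∧)
open import Data.Unit using (tt)
open import Data.Empty using (⊥-elim)
open import Data.Product using (Σ; ∃-syntax; _×_; _,_; proj₁; proj₂)
open import Data.Sum using (_⊎_; inj₁; inj₂; [_,_]; map₁)
open import Function using (_∘_; Injective)
open import Function.Bundles using (Equivalence)
open import Relation.Nullary using (¬_; Dec; yes; no; contradiction)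
open import Relation.Nullary.Decidable using (map′; decidable-stable)
open import Relation.Binary.PropositionalEquality
  using (_≡_; _≢_; refl; sym; trans; cong; subst; subst₂; module ≡-Reasoning)
open ≡-Reasoning

private
  variable
    A : Set
    m n : ℕ

lookup-ext : (xs ys : Vec A n) → (∀ i → lookup xs i ≡ lookup ys i) → xs ≡ ys
lookup-ext xs ys same = begin
  xs                   ≡⟨ sym (tabulate∘lookup xs) ⟩
  tabulate (lookup xs) ≡⟨ tabulate-cong same ⟩
  tabulate (lookup ys) ≡⟨ tabulate∘lookup ys ⟩
  ys                   ∎

lookup-∷ʳ : (xs : Vec A n) (y : A) (j : Fin n) → lookup (xs ∷ʳ y) (inject₁ j) ≡ lookup xs j
lookup-∷ʳ (x ∷ xs) y F.zero    = refl
lookup-∷ʳ (x ∷ xs) y (F.suc j) = lookup-∷ʳ xs y j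

∈-∷ʳ⁺ : (xs : Vec A n) (y : A) → y ∈ xs ∷ʳ y
∈-∷ʳ⁺ []       y = here refl
∈-∷ʳ⁺ (x ∷ xs) y = there (∈-∷ʳ⁺ xs y)

∈-∷ʳ⁻ : {a y : A} (xs : Vec A n) → a ∈ xs ∷ʳ y → a ∈ xs ⊎ a ≡ y
∈-∷ʳ⁻ []       (here a≡y)  = inj₂ a≡y
∈-∷ʳ⁻ (x ∷ xs) (here a≡x)  = inj₁ (here a≡x)
∈-∷ʳ⁻ (x ∷ xs) (there a∈) = map₁ there (∈-∷ʳ⁻ xs a∈)

lookup-shift : (w : Vec A (suc n)) (y : A) (j : Fin n) → lookup (shift w y) (inject₁ j) ≡ lookup w (F.suc j)
lookup-shift (x ∷ xs) y j = lookup-∷ʳ xs y j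

∈-shift : (w : Vec A (suc n)) (y : A) → y ∈ shift w y
∈-shift (x ∷ xs) y = ∈-∷ʳ⁺ xs y

injective⇒surjective : (f : Fin n → Fin n) → Injective _≡_ _≡_ f → ∀ a → ∃[ i ] f i ≡ a
injective⇒surjective {zero}  f f-inj ()
injective⇒surjective {suc n} f f-inj a with any? (λ i → f i F.≟ a)
... | yes hit  = hit
... | no  miss = contradiction (injective⇒≤ punchOut-a-injective) 1+n≰n
  where
  a≢f : ∀ i → a ≢ f i
  a≢f i a≡fi = miss (i , sym a≡fi)
  punchOut-a-injective : Injective _≡_ _≡_ (λ i → punchOut (a≢f i))
  punchOut-a-injective {i} {j} e = f-inj (punchOut-injective (a≢f i) (a≢f j) e)

⟨$⟩ʳ-injective : (σ : Permutation′ m) → Injective _≡_ _≡_ (σ ⟨$⟩ʳ_)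
⟨$⟩ʳ-injective σ e = trans (sym (inverseˡ σ)) (trans (cong (σ ⟨$⟩ˡ_) e) (inverseˡ σ))

reached-from-successor : (π : Permutation′ (suc n)) {p r : Fin (suc n)} →
                         π ⟨$⟩ʳ F.zero ≡ p → r ≢ p → ∃[ s ] π ⟨$⟩ʳ F.suc s ≡ r
reached-from-successor π {r = r} π0≡p r≢p with π ⟨$⟩ˡ r in eq
... | F.zero  = contradiction (trans (sym (inverseʳ π)) (trans (cong (π ⟨$⟩ʳ_) eq) π0≡p)) r≢p
... | F.suc s = s , trans (cong (π ⟨$⟩ʳ_) (sym eq)) (inverseʳ π)

occurs⇒∈ : {a : Fin m} (xs : Vec (Fin m) n) → T (occurs a xs) → a ∈ xs
occurs⇒∈ {a = a} (x ∷ xs) t with a F.≟ x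
... | yes a≡x = here a≡x
... | no  _   = there (occurs⇒∈ xs t)

∈⇒occurs : {a : Fin m} {xs : Vec (Fin m) n} → a ∈ xs → T (occurs a xs)
∈⇒occurs {a = a} (here {x = x} a≡x) with a F.≟ x
... | yes _   = tt
... | no  a≢x = contradiction a≡x a≢x
∈⇒occurs {a = a} (there {x = x} a∈) with a F.≟ x
... | yes _ = tt
... | no  _ = ∈⇒occurs a∈

T-not⇒¬T : {b : Bool} → T (not b) → ¬ T b
T-not⇒¬T {false} _ ()

¬T⇒T-not : {b : Bool} → ¬ T b → T (not b)
¬T⇒T-not {true}  ¬t = ¬t tt
¬T⇒T-not {false} _  = tt

distinct-∷⁻ : {x : Fin m} {xs : Vec (Fin m) n} → T (distinct (x ∷ xs)) → x ∉ xs × T (distinct xs)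
distinct-∷⁻ d with Equivalence.to T-∧ d
... | fresh , rest = T-not⇒¬T fresh ∘ ∈⇒occurs , rest

distinct-∷⁺ : {x : Fin m} {xs : Vec (Fin m) n} → x ∉ xs → T (distinct xs) → T (distinct (x ∷ xs))
distinct-∷⁺ {x = x} {xs} x∉xs d = Equivalence.from T-∧ (¬T⇒T-not (x∉xs ∘ occurs⇒∈ xs) , d)

InjectiveWord : Vec (Fin m) n → Set
InjectiveWord w = Injective _≡_ _≡_ (lookup w)

distinct⇒injective : (w : Vec (Fin m) n) → T (distinct w) → InjectiveWord w
distinct⇒injective (x ∷ xs) d {F.zero}  {F.zero}  e = refl
distinct⇒injective (x ∷ xs) d {F.zero}  {F.suc j} e =
  ⊥-elim (proj₁ (distinct-∷⁻ d) (subst (_∈ xs) (sym e) (∈-lookup j xs)))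
distinct⇒injective (x ∷ xs) d {F.suc i} {F.zero}  e =
  ⊥-elim (proj₁ (distinct-∷⁻ d) (subst (_∈ xs) e (∈-lookup i xs)))
distinct⇒injective (x ∷ xs) d {F.suc i} {F.suc j} e =
  cong F.suc (distinct⇒injective xs (proj₂ (distinct-∷⁻ {x = x} {xs = xs} d)) e)

injective⇒distinct : (w : Vec (Fin m) n) → InjectiveWord w → T (distinct w)
injective⇒distinct []       _   = tt
injective⇒distinct (x ∷ xs) inj = distinct-∷⁺ x∉xs (injective⇒distinct xs (suc-injective ∘ inj))
  where
  x∉xs : x ∉ xs
  x∉xs x∈xs = 0≢1+n (inj {F.zero} {F.suc (index x∈xs)} (lookup-index x∈xs))

tabulate-injective : {f : Fin n → Fin m} → Injective _≡_ _≡_ f → InjectiveWord (tabulate f)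
tabulate-injective {f = f} f-inj {i} {j} e = f-inj (begin
  f i                   ≡⟨ sym (lookup∘tabulate f i) ⟩
  lookup (tabulate f) i ≡⟨ e ⟩
  lookup (tabulate f) j ≡⟨ lookup∘tabulate f j ⟩
  f j                   ∎)

distinct-∷ʳ : (xs : Vec (Fin m) n) {y : Fin m} → T (distinct xs) → y ∉ xs → T (distinct (xs ∷ʳ y))
distinct-∷ʳ []       _ _   = tt
distinct-∷ʳ (x ∷ xs) {y} d y∉ with distinct-∷⁻ d
... | x∉xs , rest = distinct-∷⁺ x∉ (distinct-∷ʳ xs rest (y∉ ∘ there))
  where
  x∉ : x ∉ xs ∷ʳ y
  x∉ x∈ = [ x∉xs , (λ x≡y → y∉ (here (sym x≡y))) ] (∈-∷ʳ⁻ xs x∈)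

distinct-shift : (w : Vec (Fin m) (suc n)) {y : Fin m} → T (distinct w) → y ∉ w → T (distinct (shift w y))
distinct-shift (x ∷ xs) d y∉ = distinct-∷ʳ xs (proj₂ (distinct-∷⁻ {x = x} {xs = xs} d)) (y∉ ∘ there)

infix 5 _!_
infix 4 _∈ᵛ_ _⊆_ _∈ᵛ?_ _⊆?_

_!_ : Vertex m n → Fin n → Fin m
v ! i = lookup (word v) i

mkVertex : (w : Vec (Fin m) n) → InjectiveWord w → Vertex m n
mkVertex w inj = w , injective⇒distinct w inj

vertex-injective : (v : Vertex m n) → Injective _≡_ _≡_ (v !_)
vertex-injective (w , d) = distinct⇒injective w d

vertex-≡ : {u v : Vertex m n} → word u ≡ word v → u ≡ v
vertex-≡ {u = w , d} {v = .w , d′} refl = cong (w ,_) (T-irrelevant d d′)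

vertex-ext : {u v : Vertex m n} → (∀ i → u ! i ≡ v ! i) → u ≡ v
vertex-ext {u = u} {v} same = vertex-≡ (lookup-ext (word u) (word v) same)

_∈ᵛ_ : Fin m → Vertex m n → Set
a ∈ᵛ v = ∃[ i ] v ! i ≡ a

_⊆_ : Vertex m n → Vertex m n → Set
u ⊆ v = ∀ i → u ! i ∈ᵛ v

∈⇒∈ᵛ : {a : Fin m} {v : Vertex m n} → a ∈ word v → a ∈ᵛ v
∈⇒∈ᵛ a∈v = index a∈v , sym (lookup-index a∈v)

∈ᵛ⇒∈ : {a : Fin m} {v : Vertex m n} → a ∈ᵛ v → a ∈ word v
∈ᵛ⇒∈ {v = v} (i , vi≡a) = subst (_∈ word v) vi≡a (∈-lookup i (word v))

∈ᵛ-⊆ : {a : Fin m} {u v : Vertex m n} → u ⊆ v → a ∈ᵛ u → a ∈ᵛ v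
∈ᵛ-⊆ u⊆v (i , ui≡a) with u⊆v i
... | j , vj≡ui = j , trans vj≡ui ui≡a

_∈ᵛ?_ : (a : Fin m) (v : Vertex m n) → Dec (a ∈ᵛ v)
a ∈ᵛ? v = any? (λ i → v ! i F.≟ a)

_⊆?_ : (u v : Vertex m n) → Dec (u ⊆ v)
u ⊆? v = all? (λ i → u ! i ∈ᵛ? v)

⊆-positions-injective : (u v : Vertex m n) (u⊆v : u ⊆ v) → Injective _≡_ _≡_ (proj₁ ∘ u⊆v)
⊆-positions-injective u v u⊆v {i} {j} e = vertex-injective u (begin
  u ! i             ≡⟨ sym (proj₂ (u⊆v i)) ⟩
  v ! proj₁ (u⊆v i) ≡⟨ cong (v !_) e ⟩
  v ! proj₁ (u⊆v j) ≡⟨ proj₂ (u⊆v j) ⟩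
  u ! j             ∎)

⊆-flip : {u v : Vertex m n} → u ⊆ v → v ⊆ u
⊆-flip {u = u} {v} u⊆v j with injective⇒surjective (proj₁ ∘ u⊆v) (⊆-positions-injective u v u⊆v) j
... | i , posi≡j = i , trans (sym (proj₂ (u⊆v i))) (cong (v !_) posi≡j)

⊆⇒same : {u v : Vertex m n} → u ⊆ v → SameAlphabet u v
⊆⇒same {u = u} {v} u⊆v a =
    (λ a∈u → ∈ᵛ⇒∈ {v = v} (∈ᵛ-⊆ {u = u} {v} u⊆v (∈⇒∈ᵛ {v = u} a∈u)))
  , (λ a∈v → ∈ᵛ⇒∈ {v = u} (∈ᵛ-⊆ {u = v} {u} (⊆-flip {u = u} {v} u⊆v) (∈⇒∈ᵛ {v = v} a∈v)))

same⇒⊆ : {u v : Vertex m n} → SameAlphabet u v → u ⊆ v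
same⇒⊆ {u = u} {v} same i = ∈⇒∈ᵛ {v = v} (proj₁ (same (u ! i)) (∈-lookup i (word u)))

same? : (u v : Vertex m n) → Dec (SameAlphabet u v)
same? u v = map′ (⊆⇒same {u = u} {v}) (same⇒⊆ {u = u} {v}) (u ⊆? v)

permutationArc⇒same : {u v : Vertex m n} (π : Permutation′ n) →
                      word v ≡ permuteWord π (word u) → SameAlphabet u v
permutationArc⇒same {u = u} {v} π refl =
  ⊆⇒same {u = u} {v} (⊆-flip {u = v} {u} λ i →
    π ⟨$⟩ʳ i , sym (lookup∘tabulate (λ j → u ! (π ⟨$⟩ʳ j)) i))

shiftArc⇒¬same : {u v : Vertex m (suc n)} {y : Fin m} →
                 y ∉ word u → word v ≡ shift (word u) y → ¬ SameAlphabet u v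
shiftArc⇒¬same {u = x ∷ xs , d} {v = _ , _} {y} y∉ refl same =
  [ proj₁ (distinct-∷⁻ {x = x} {xs = xs} d) , (λ x≡y → y∉ (here (sym x≡y))) ]
    (∈-∷ʳ⁻ xs (proj₁ (same x) (here refl)))

shiftVertex : (v : Vertex m (suc n)) (y : Fin m) → y ∉ word v → Vertex m (suc n)
shiftVertex v y y∉ = shift (word v) y , distinct-shift (word v) (proj₂ v) y∉

shiftVertex-∋ : (v : Vertex m (suc n)) (y : Fin m) (y∉ : y ∉ word v) → y ∈ᵛ shiftVertex v y y∉
shiftVertex-∋ v y y∉ = ∈⇒∈ᵛ {v = shiftVertex v y y∉} (∈-shift (word v) y)

initialVertex : n ≤ m → Vertex m n
initialVertex n≤m = mkVertex (tabulate (λ i → inject≤ i n≤m))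
  (tabulate-injective λ {i} {j} → inject≤-injective n≤m n≤m i j)

vertexContaining : suc n ≤ m → (a : Fin m) → Σ (Vertex m (suc n)) (a ∈ᵛ_)
vertexContaining n<m a with a ∈ᵛ? initialVertex n<m
... | yes a∈ = initialVertex n<m , a∈
... | no  a∉ = shiftVertex (initialVertex n<m) a a∉′ , shiftVertex-∋ (initialVertex n<m) a a∉′
  where
  a∉′ : a ∉ word (initialVertex n<m)
  a∉′ = a∉ ∘ ∈⇒∈ᵛ {v = initialVertex n<m}

-- Reindexing v∘t: the j-th letter is the letter of v at position t j.
-- The vertices of Γ_n index the words with the alphabet of v.
reindexWord : Vec (Fin m) n → Vec (Fin n) n → Vec (Fin m) n
reindexWord w t = tabulate (λ j → lookup w (lookup t j))

lookup-reindexWord : (w : Vec (Fin m) n) (t : Vec (Fin n) n) (j : Fin n) →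
                     lookup (reindexWord w t) j ≡ lookup w (lookup t j)
lookup-reindexWord w t = lookup∘tabulate (λ j → lookup w (lookup t j))

reindexWord-injective : {w : Vec (Fin m) n} → InjectiveWord w → {t t′ : Vec (Fin n) n} →
                        reindexWord w t ≡ reindexWord w t′ → t ≡ t′
reindexWord-injective {w = w} w-inj {t} {t′} e = lookup-ext t t′ λ j → w-inj (begin
  lookup w (lookup t j)       ≡⟨ sym (lookup-reindexWord w t j) ⟩
  lookup (reindexWord w t) j  ≡⟨ cong (λ x → lookup x j) e ⟩
  lookup (reindexWord w t′) j ≡⟨ lookup-reindexWord w t′ j ⟩
  lookup w (lookup t′ j)      ∎)

permute-reindexWord : (π : Permutation′ n) (w : Vec (Fin m) n) (t : Vec (Fin n) n) →
                      permuteWord π (reindexWord w t) ≡ reindexWord w (permuteWord π t)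
permute-reindexWord π w t = lookup-ext _ _ λ j → begin
  lookup (permuteWord π (reindexWord w t)) j ≡⟨ lookup∘tabulate _ j ⟩
  lookup (reindexWord w t) (π ⟨$⟩ʳ j)         ≡⟨ lookup-reindexWord w t (π ⟨$⟩ʳ j) ⟩
  lookup w (lookup t (π ⟨$⟩ʳ j))              ≡⟨ cong (lookup w) (sym (lookup∘tabulate _ j)) ⟩
  lookup w (lookup (permuteWord π t) j)       ≡⟨ sym (lookup-reindexWord w (permuteWord π t) j) ⟩
  lookup (reindexWord w (permuteWord π t)) j  ∎

reindex : Vertex m n → Vertex n n → Vertex m n
reindex v t = mkVertex (reindexWord (word v) (word t))
  (tabulate-injective (vertex-injective t ∘ vertex-injective v))

reindex-! : (v : Vertex m n) (t : Vertex n n) (j : Fin n) → reindex v t ! j ≡ v ! (t ! j)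
reindex-! v t = lookup-reindexWord (word v) (word t)

reindex-injective : (v : Vertex m n) {t t′ : Vertex n n} → reindex v t ≡ reindex v t′ → t ≡ t′
reindex-injective v e = vertex-≡ (reindexWord-injective {w = word v} (vertex-injective v) (cong word e))

reindex-⊆ : (v : Vertex m n) (t : Vertex n n) → reindex v t ⊆ v
reindex-⊆ v t j = t ! j , sym (reindex-! v t j)

positions : (u v : Vertex m n) → u ⊆ v → Vertex n n
positions u v u⊆v =
  mkVertex (tabulate (proj₁ ∘ u⊆v)) (tabulate-injective (⊆-positions-injective u v u⊆v))

reindex-positions : (u v : Vertex m n) (u⊆v : u ⊆ v) → reindex v (positions u v u⊆v) ≡ u
reindex-positions u v u⊆v = vertex-ext λ j → begin
  reindex v (positions u v u⊆v) ! j ≡⟨ reindex-! v (positions u v u⊆v) j ⟩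
  v ! (positions u v u⊆v ! j)       ≡⟨ cong (v !_) (lookup∘tabulate (proj₁ ∘ u⊆v) j) ⟩
  v ! proj₁ (u⊆v j)                 ≡⟨ proj₂ (u⊆v j) ⟩
  u ! j                             ∎

permutationVertex : Permutation′ n → Vertex n n
permutationVertex π = mkVertex (tabulate (π ⟨$⟩ʳ_)) (tabulate-injective (⟨$⟩ʳ-injective π))

reindex-permutation-! : (v : Vertex m n) (π : Permutation′ n) (j : Fin n) →
                        reindex v (permutationVertex π) ! j ≡ v ! (π ⟨$⟩ʳ j)
reindex-permutation-! v π j =
  trans (reindex-! v (permutationVertex π) j) (cong (v !_) (lookup∘tabulate (π ⟨$⟩ʳ_) j))

identityVertex : Vertex n n
identityVertex = permutationVertex Perm.id

reindex-identity : (v : Vertex m n) → reindex v identityVertex ≡ v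
reindex-identity v = vertex-ext (reindex-permutation-! v Perm.id)

mkAutomorphism : {V : Set} {E : V → V → Set} (f g : V → V) →
                 (∀ v → f (g v) ≡ v) → (∀ v → g (f v) ≡ v) →
                 (∀ u v → E u v → E (f u) (f v)) → (∀ u v → E u v → E (g u) (g v)) →
                 Automorphism V E
mkAutomorphism {E = E} f g fg gf f-arc g-arc = record
  { to = f ; from = g ; to∘from = fg ; from∘to = gf ; preserve = f-arc
  ; reflect = λ u v e → subst₂ E (gf u) (gf v) (g-arc _ _ e) }

inverse : {V : Set} {E : V → V → Set} → Automorphism V E → Automorphism V E
inverse {E = E} φ = mkAutomorphism (from φ) (to φ) (from∘to φ) (to∘from φ)
  (λ u v e → reflect φ _ _ (subst₂ E (sym (to∘from φ u)) (sym (to∘from φ v)) e))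
  (preserve φ)

relabel : Permutation′ m → Vertex m n → Vertex m n
relabel σ v = mkVertex (map (σ ⟨$⟩ʳ_) (word v)) λ {i} {j} e →
  vertex-injective v (⟨$⟩ʳ-injective σ (begin
    σ ⟨$⟩ʳ (v ! i)                  ≡⟨ sym (lookup-map i (σ ⟨$⟩ʳ_) (word v)) ⟩
    lookup (map (σ ⟨$⟩ʳ_) (word v)) i ≡⟨ e ⟩
    lookup (map (σ ⟨$⟩ʳ_) (word v)) j ≡⟨ lookup-map j (σ ⟨$⟩ʳ_) (word v) ⟩
    σ ⟨$⟩ʳ (v ! j)                  ∎))

relabel-! : (σ : Permutation′ m) (v : Vertex m n) (i : Fin n) → relabel σ v ! i ≡ σ ⟨$⟩ʳ (v ! i)
relabel-! σ v i = lookup-map i (σ ⟨$⟩ʳ_) (word v)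

relabel-cancel : (σ τ : Permutation′ m) → (∀ a → τ ⟨$⟩ʳ (σ ⟨$⟩ʳ a) ≡ a) →
                 (v : Vertex m n) → relabel τ (relabel σ v) ≡ v
relabel-cancel σ τ cancel v = vertex-ext λ i → begin
  relabel τ (relabel σ v) ! i ≡⟨ relabel-! τ (relabel σ v) i ⟩
  τ ⟨$⟩ʳ (relabel σ v ! i)    ≡⟨ cong (τ ⟨$⟩ʳ_) (relabel-! σ v i) ⟩
  τ ⟨$⟩ʳ (σ ⟨$⟩ʳ (v ! i))     ≡⟨ cancel (v ! i) ⟩
  v ! i                       ∎

map-shift : (f : Fin m → Fin m) (w : Vec (Fin m) n) (y : Fin m) →
            map f (shift w y) ≡ shift (map f w) (f y)
map-shift f []       y = refl
map-shift f (x ∷ xs) y = map-∷ʳ f y xs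

map-permuteWord : (f : Fin m → Fin m) (π : Permutation′ n) (w : Vec (Fin m) n) →
                  map f (permuteWord π w) ≡ permuteWord π (map f w)
map-permuteWord f π w = lookup-ext _ _ λ i → begin
  lookup (map f (permuteWord π w)) i ≡⟨ lookup-map i f (permuteWord π w) ⟩
  f (lookup (permuteWord π w) i)     ≡⟨ cong f (lookup∘tabulate _ i) ⟩
  f (lookup w (π ⟨$⟩ʳ i))            ≡⟨ sym (lookup-map (π ⟨$⟩ʳ i) f w) ⟩
  lookup (map f w) (π ⟨$⟩ʳ i)        ≡⟨ sym (lookup∘tabulate _ i) ⟩
  lookup (permuteWord π (map f w)) i ∎

relabel-arc : {Π : List (Permutation′ n)} (σ : Permutation′ m) (u v : Vertex m n) →
              Arc m Π u v → Arc m Π (relabel σ u) (relabel σ v)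
relabel-arc σ u v (inj₁ (y , y∉ , e)) =
  inj₁ (σ ⟨$⟩ʳ y , σy∉ , trans (cong (map (σ ⟨$⟩ʳ_)) e) (map-shift (σ ⟨$⟩ʳ_) (word u) y))
  where
  σy∉ : σ ⟨$⟩ʳ y ∉ word (relabel σ u)
  σy∉ σy∈ with ∈⇒∈ᵛ {v = relabel σ u} σy∈
  ... | i , ui≡σy = y∉ (∈ᵛ⇒∈ {v = u} (i , ⟨$⟩ʳ-injective σ (trans (sym (relabel-! σ u i)) ui≡σy)))
relabel-arc σ u v (inj₂ arc) =
  inj₂ (ListAny.map (λ {π} e →
    trans (cong (map (σ ⟨$⟩ʳ_)) e) (map-permuteWord (σ ⟨$⟩ʳ_) π (word u))) arc)

relabelAut : {Π : List (Permutation′ n)} → Permutation′ m → AutG m Π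
relabelAut σ = mkAutomorphism (relabel σ) (relabel (Perm.flip σ))
  (relabel-cancel (Perm.flip σ) σ (λ _ → inverseʳ σ))
  (relabel-cancel σ (Perm.flip σ) (λ _ → inverseˡ σ))
  (relabel-arc σ) (relabel-arc (Perm.flip σ))

relabel-homomorphism : {Π : List (Permutation′ n)} (σ τ : Permutation′ m) (v : Vertex m n) →
                       to (relabelAut {Π = Π} (τ ∘ₚ σ)) v
                         ≡ to (relabelAut {Π = Π} σ) (to (relabelAut {Π = Π} τ) v)
relabel-homomorphism σ τ v = vertex-≡ (map-∘ (σ ⟨$⟩ʳ_) (τ ⟨$⟩ʳ_) (word v))

-- Every letter lies in a vertex, so distinct permutations relabel some
-- vertex differently.
relabel-faithful : {Π : List (Permutation′ (suc n))} → suc n ≤ m → (σ τ : Permutation′ m) →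
                   (∀ v → to (relabelAut {Π = Π} σ) v ≡ to (relabelAut {Π = Π} τ) v) →
                   ∀ a → σ ⟨$⟩ʳ a ≡ τ ⟨$⟩ʳ a
relabel-faithful n<m σ τ same a with vertexContaining n<m a
... | v , i , vi≡a = begin
  σ ⟨$⟩ʳ a          ≡⟨ cong (σ ⟨$⟩ʳ_) (sym vi≡a) ⟩
  σ ⟨$⟩ʳ (v ! i)    ≡⟨ sym (relabel-! σ v i) ⟩
  relabel σ v ! i   ≡⟨ cong (_! i) (same v) ⟩
  relabel τ v ! i   ≡⟨ relabel-! τ v i ⟩
  τ ⟨$⟩ʳ (v ! i)    ≡⟨ cong (τ ⟨$⟩ʳ_) vi≡a ⟩
  τ ⟨$⟩ʳ a          ∎

module Stability {m k : ℕ} {Π : List (Permutation′ (suc k))} (stable : AlphabetStable m Π) where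

  V : Set
  V = Vertex m (suc k)

  Aut : Set
  Aut = AutG m Π

  PermutationArc : V → V → Set
  PermutationArc u v = ListAny.Any (λ π → word v ≡ permuteWord π (word u)) Π

  -- SameAlphabet is decidable, so the negative form of stability suffices.
  preserves-alphabet : (φ : Aut) {u v : V} → SameAlphabet u v → SameAlphabet (to φ u) (to φ v)
  preserves-alphabet φ {u} {v} same =
    decidable-stable (same? (to φ u) (to φ v)) (λ differ → stable (φ , u , v , same , differ))

  reflects-alphabet : (φ : Aut) {u v : V} → SameAlphabet (to φ u) (to φ v) → SameAlphabet u v
  reflects-alphabet φ {u} {v} same =
    subst₂ SameAlphabet (from∘to φ u) (from∘to φ v) (preserves-alphabet (inverse φ) same)

  permutationArc-same : {u v : V} → PermutationArc u v → SameAlphabet u v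
  permutationArc-same {u} {v} arc with ListAny.satisfied arc
  ... | π , e = permutationArc⇒same {u = u} {v} π e

  permutationArc-preserved : (φ : Aut) {u v : V} → PermutationArc u v → PermutationArc (to φ u) (to φ v)
  permutationArc-preserved φ {u} {v} arc with preserve φ u v (inj₂ arc)
  ... | inj₁ (_ , y∉ , e) =
    ⊥-elim (shiftArc⇒¬same {u = to φ u} {to φ v} y∉ e
      (preserves-alphabet φ (permutationArc-same {u} {v} arc)))
  ... | inj₂ arc′         = arc′

  shiftArc-preserved : (φ : Aut) {u v : V} {y : Fin m} → y ∉ word u → word v ≡ shift (word u) y →
                       ∃[ z ] (z ∉ word (to φ u) × word (to φ v) ≡ shift (word (to φ u)) z)
  shiftArc-preserved φ {u} {v} y∉ e with preserve φ u v (inj₁ (_ , y∉ , e))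
  ... | inj₁ shiftArc = shiftArc
  ... | inj₂ arc′     =
    ⊥-elim (shiftArc⇒¬same {u = u} {v} y∉ e
      (reflects-alphabet φ (permutationArc-same {to φ u} {to φ v} arc′)))

module Rigidity {m k : ℕ} {Π : List (Permutation′ (suc k))}
                (stable : AlphabetStable m Π) (subregular : Subregular (suc k) Π) where

  open Stability stable

  Γ : Set
  Γ = Vertex (suc k) (suc k)

  -- Conjugating φ to the alphabet class of w: φ sends w∘t to (φ w)∘(ψ t).
  module Induced (φ : Aut) (w : V) where

    image-⊆ : (t : Γ) → to φ (reindex w t) ⊆ to φ w
    image-⊆ t = same⇒⊆ {u = to φ (reindex w t)} {to φ w}
      (preserves-alphabet φ (⊆⇒same {u = reindex w t} {w} (reindex-⊆ w t)))

    ψ : Γ → Γ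
    ψ t = positions (to φ (reindex w t)) (to φ w) (image-⊆ t)

    ψ-spec : (t : Γ) → reindex (to φ w) (ψ t) ≡ to φ (reindex w t)
    ψ-spec t = reindex-positions (to φ (reindex w t)) (to φ w) (image-⊆ t)

    ψ-unique : {t s : Γ} → reindex (to φ w) s ≡ to φ (reindex w t) → ψ t ≡ s
    ψ-unique {t} e = reindex-injective (to φ w) (trans (ψ-spec t) (sym e))

    -- ψ preserves arcs of Γ_n because φ preserves permutation arcs.
    ψ-arc : (t t′ : Γ) → GammaArc Π t t′ → GammaArc Π (ψ t) (ψ t′)
    ψ-arc t t′ arc = ListAny.map (λ {π} → image {π})
      (permutationArc-preserved φ {reindex w t} {reindex w t′} (ListAny.map (λ {π} → lift {π}) arc))
      where
      lift : ∀ {π} → word t′ ≡ permuteWord π (word t) →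
             word (reindex w t′) ≡ permuteWord π (word (reindex w t))
      lift {π} e = trans (cong (reindexWord (word w)) e) (sym (permute-reindexWord π (word w) (word t)))
      image : ∀ {π} → word (to φ (reindex w t′)) ≡ permuteWord π (word (to φ (reindex w t))) →
              word (ψ t′) ≡ permuteWord π (word (ψ t))
      image {π} e = reindexWord-injective {w = W} (vertex-injective (to φ w)) (begin
        reindexWord W (word (ψ t′))                ≡⟨ cong word (ψ-spec t′) ⟩
        word (to φ (reindex w t′))                 ≡⟨ e ⟩
        permuteWord π (word (to φ (reindex w t)))  ≡⟨ cong (permuteWord π ∘ word) (sym (ψ-spec t)) ⟩
        permuteWord π (reindexWord W (word (ψ t))) ≡⟨ permute-reindexWord π W (word (ψ t)) ⟩
        reindexWord W (permuteWord π (word (ψ t))) ∎)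
        where
        W : Vec (Fin m) (suc k)
        W = word (to φ w)

  open Induced using (ψ; ψ-spec; ψ-unique; ψ-arc)

  ψ-cancel : (χ χ′ : Aut) (w w′ : V) → (∀ v → to χ′ (to χ v) ≡ v) → to χ w ≡ w′ →
             ∀ t → ψ χ′ w′ (ψ χ w t) ≡ t
  ψ-cancel χ χ′ w _ cancel refl t = ψ-unique χ′ (to χ w) {ψ χ w t} {t} (begin
    reindex (to χ′ (to χ w)) t           ≡⟨ cong (λ x → reindex x t) (cancel w) ⟩
    reindex w t                          ≡⟨ sym (cancel (reindex w t)) ⟩
    to χ′ (to χ (reindex w t))           ≡⟨ cong (to χ′) (sym (ψ-spec χ w t)) ⟩
    to χ′ (reindex (to χ w) (ψ χ w t))   ∎)

  inducedAutomorphism : Aut → V → Automorphism Γ (GammaArc Π)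
  inducedAutomorphism φ w = mkAutomorphism (ψ φ w) (ψ (inverse φ) (to φ w))
    (ψ-cancel (inverse φ) φ (to φ w) w (to∘from φ) (from∘to φ w))
    (ψ-cancel φ (inverse φ) w (to φ w) (from∘to φ) refl)
    (ψ-arc φ w) (ψ-arc (inverse φ) (to φ w))

  -- Subregularity: the induced automorphism relabels letters of Fin (suc k);
  -- it fixes the identity word, so it is trivial and φ(w∘t) = (φ w)∘t.
  reindex-commutes : (φ : Aut) (w : V) (t : Γ) → to φ (reindex w t) ≡ reindex (to φ w) t
  reindex-commutes φ w t = begin
    to φ (reindex w t)         ≡⟨ sym (ψ-spec φ w t) ⟩
    reindex (to φ w) (ψ φ w t) ≡⟨ cong (reindex (to φ w)) (ψ-trivial t) ⟩
    reindex (to φ w) t         ∎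
    where
    σ : Permutation′ (suc k)
    σ = proj₁ (subregular (inducedAutomorphism φ w))

    ψ-relabels : ∀ t j → ψ φ w t ! j ≡ σ ⟨$⟩ʳ (t ! j)
    ψ-relabels t j = trans (cong (λ x → lookup x j) (proj₂ (subregular (inducedAutomorphism φ w)) t))
                           (lookup-map j (σ ⟨$⟩ʳ_) (word t))

    ψ-identity : ψ φ w identityVertex ≡ identityVertex
    ψ-identity = ψ-unique φ w {identityVertex} {identityVertex} (begin
      reindex (to φ w) identityVertex ≡⟨ reindex-identity (to φ w) ⟩
      to φ w                          ≡⟨ cong (to φ) (sym (reindex-identity w)) ⟩
      to φ (reindex w identityVertex) ∎)

    σ-trivial : ∀ i → σ ⟨$⟩ʳ i ≡ i
    σ-trivial i = begin
      σ ⟨$⟩ʳ i                      ≡⟨ cong (σ ⟨$⟩ʳ_) (sym (lookup∘tabulate (λ j → j) i)) ⟩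
      σ ⟨$⟩ʳ (identityVertex ! i)   ≡⟨ sym (ψ-relabels identityVertex i) ⟩
      ψ φ w identityVertex ! i      ≡⟨ cong (_! i) ψ-identity ⟩
      identityVertex ! i            ≡⟨ lookup∘tabulate (λ j → j) i ⟩
      i                             ∎

    ψ-trivial : ∀ t → ψ φ w t ≡ t
    ψ-trivial t = vertex-ext {u = ψ φ w t} {t} λ j → trans (ψ-relabels t j) (σ-trivial (t ! j))

  ⊆-agree : (φ : Aut) (u v : V) → u ⊆ v → {i j : Fin (suc k)} →
            u ! i ≡ v ! j → to φ u ! i ≡ to φ v ! j
  ⊆-agree φ u v u⊆v {i} {j} ui≡vj = begin
    to φ u ! i             ≡⟨ cong (λ x → to φ x ! i) (sym (reindex-positions u v u⊆v)) ⟩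
    to φ (reindex v t) ! i ≡⟨ cong (_! i) (reindex-commutes φ v t) ⟩
    reindex (to φ v) t ! i ≡⟨ reindex-! (to φ v) t i ⟩
    to φ v ! (t ! i)       ≡⟨ cong (to φ v !_) ti≡j ⟩
    to φ v ! j             ∎
    where
    t : Γ
    t = positions u v u⊆v
    ti≡j : t ! i ≡ j
    ti≡j = vertex-injective v (begin
      v ! (t ! i)      ≡⟨ sym (reindex-! v t i) ⟩
      reindex v t ! i  ≡⟨ cong (_! i) (reindex-positions u v u⊆v) ⟩
      u ! i            ≡⟨ ui≡vj ⟩
      v ! j            ∎)

  -- φ maps a shift arc to a shift arc, so the letters that survive the shift
  -- keep their images.
  shift-agree : (φ : Aut) (v : V) {y : Fin m} (y∉ : y ∉ word v) (j : Fin k) →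
                to φ (shiftVertex v y y∉) ! inject₁ j ≡ to φ v ! F.suc j
  shift-agree φ v {y} y∉ j with shiftArc-preserved φ {v} {shiftVertex v y y∉} y∉ refl
  ... | z , _ , e = trans (cong (λ x → lookup x (inject₁ j)) e) (lookup-shift (word (to φ v)) z j)

  record Exchange (φ : Aut) (v : V) (p : Fin (suc k)) (y : Fin m) : Set where
    field
      result   : V
      contains : y ∈ᵛ result
      keeps    : ∀ r → r ≢ p → ∃[ s ] (result ! s ≡ v ! r × to φ result ! s ≡ to φ v ! r)

  -- Bring position p to the front by a transposition, then shift in y.
  exchange : (φ : Aut) (v : V) (p : Fin (suc k)) {y : Fin m} → y ∉ word v → Exchange φ v p y
  exchange φ v p {y} y∉v = record
    { result = v′ ; contains = shiftVertex-∋ u y y∉u ; keeps = keeps }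
    where
    τ : Permutation′ (suc k)
    τ = transpose F.zero p
    τ′ : Γ
    τ′ = permutationVertex τ
    u : V
    u = reindex v τ′
    y∉u : y ∉ word u
    y∉u = y∉v ∘ ∈ᵛ⇒∈ {v = v} ∘ ∈ᵛ-⊆ {u = u} {v} (reindex-⊆ v τ′) ∘ ∈⇒∈ᵛ {v = u}
    v′ : V
    v′ = shiftVertex u y y∉u
    keeps : ∀ r → r ≢ p → ∃[ s ] (v′ ! s ≡ v ! r × to φ v′ ! s ≡ to φ v ! r)
    keeps r r≢p with reached-from-successor τ refl r≢p
    ... | s , τs≡r = inject₁ s
      , (begin
        v′ ! inject₁ s                              ≡⟨ lookup-shift (word u) y s ⟩
        u ! F.suc s                                 ≡⟨ reindex-permutation-! v τ (F.suc s) ⟩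
        v ! (τ ⟨$⟩ʳ F.suc s)                         ≡⟨ cong (v !_) τs≡r ⟩
        v ! r                                       ∎)
      , (begin
        to φ v′ ! inject₁ s                         ≡⟨ shift-agree φ u y∉u s ⟩
        to φ u ! F.suc s                            ≡⟨ cong (_! F.suc s) (reindex-commutes φ v τ′) ⟩
        reindex (to φ v) τ′ ! F.suc s               ≡⟨ reindex-permutation-! (to φ v) τ (F.suc s) ⟩
        to φ v ! (τ ⟨$⟩ʳ F.suc s)                    ≡⟨ cong (to φ v !_) τs≡r ⟩
        to φ v ! r                                  ∎)

  -- Fix a target v′ and walk from v
  -- towards it by exchanges, never discarding a letter of v′; the positions
  -- of v′ still to be brought into v are listed in qs.
  module Consistency (φ : Aut) (v′ : V) (i′ : Fin (suc k)) where

    Covers : List (Fin (suc k)) → V → Set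
    Covers qs v = ∀ q → q ∉ₗ qs → v′ ! q ∈ᵛ v

    uncover : {q : Fin (suc k)} {qs : List (Fin (suc k))} {v : V} →
              Covers (q ∷ qs) v → v′ ! q ∈ᵛ v → Covers qs v
    uncover {q} cov q∈v q′ q′∉qs with q′ F.≟ q
    ... | yes refl = q∈v
    ... | no  q′≢q = cov q′ λ { (ListAny.here e) → q′≢q e ; (ListAny.there e) → q′∉qs e }

    cover-exchange : {qs : List (Fin (suc k))} {v : V} {p : Fin (suc k)} {y : Fin m} →
                     Covers qs v → ¬ (v ! p ∈ᵛ v′) → (ex : Exchange φ v p y) →
                     Covers qs (Exchange.result ex)
    cover-exchange cov p∉v′ ex q q∉qs with cov q q∉qs
    ... | r , vr≡v′q with Exchange.keeps ex r (λ { refl → p∉v′ (q , sym vr≡v′q) })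
    ...   | s , es , _ = s , trans es vr≡v′q

    -- Either v′ is already inside v (or v inside v′) and one alphabet class
    -- settles it, or an exchange brings in the letter at the first listed
    -- position while keeping the tracked letter v ! i.
    consistent : ∀ qs v i → v ! i ≡ v′ ! i′ → Covers qs v → to φ v ! i ≡ to φ v′ ! i′
    consistent []        v i e cov = sym (⊆-agree φ v′ v (λ q → cov q λ ()) (sym e))
    consistent (q ∷ qs) v i e cov with v′ ! q ∈ᵛ? v | v ⊆? v′
    ... | yes q∈v | _        = consistent qs v i e (uncover {v = v} cov q∈v)
    ... | no  _   | yes v⊆v′ = ⊆-agree φ v v′ v⊆v′ e
    ... | no  q∉v | no  v⊈v′ = through (exchange φ v p (q∉v ∘ ∈⇒∈ᵛ {v = v}))
      where
      outside : ∃[ p ] ¬ (v ! p ∈ᵛ v′)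
      outside = ¬∀⟶∃¬ (suc k) (λ r → v ! r ∈ᵛ v′) (λ r → v ! r ∈ᵛ? v′) v⊈v′
      p : Fin (suc k)
      p = proj₁ outside
      through : Exchange φ v p (v′ ! q) → to φ v ! i ≡ to φ v′ ! i′
      through ex with Exchange.keeps ex i (λ { refl → proj₂ outside (i′ , sym e) })
      ... | s , es , φes = trans (sym φes)
        (consistent qs (Exchange.result ex) s (trans es e)
          (uncover {v = Exchange.result ex}
            (cover-exchange {v = v} cov (proj₂ outside) ex) (Exchange.contains ex)))

  consistent-letters : (φ : Aut) (v v′ : V) {i i′ : Fin (suc k)} →
                       v ! i ≡ v′ ! i′ → to φ v ! i ≡ to φ v′ ! i′
  consistent-letters φ v v′ {i} {i′} e =
    Consistency.consistent φ v′ i′ (allFin (suc k)) v i e (λ q q∉ → ⊥-elim (q∉ (∈-allFin q)))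

  module _ (n<m : suc k ≤ m) where

    letterMap : Aut → Fin m → Fin m
    letterMap φ a = to φ (proj₁ (vertexContaining n<m a)) ! proj₁ (proj₂ (vertexContaining n<m a))

    letterMap-spec : (φ : Aut) (v : V) (i : Fin (suc k)) → to φ v ! i ≡ letterMap φ (v ! i)
    letterMap-spec φ v i with vertexContaining n<m (v ! i)
    ... | u , j , uj≡vi = consistent-letters φ v u (sym uj≡vi)

    letterMap-cancel : (χ χ′ : Aut) → (∀ v → to χ′ (to χ v) ≡ v) →
                       ∀ a → letterMap χ′ (letterMap χ a) ≡ a
    letterMap-cancel χ χ′ cancel a with vertexContaining n<m a
    ... | v , i , vi≡a = begin
      letterMap χ′ (to χ v ! i) ≡⟨ sym (letterMap-spec χ′ (to χ v) i) ⟩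
      to χ′ (to χ v) ! i        ≡⟨ cong (_! i) (cancel v) ⟩
      v ! i                     ≡⟨ vi≡a ⟩
      a                         ∎

    every-automorphism-relabels : (φ : Aut) → ∃[ σ ] (∀ v → to (relabelAut {Π = Π} σ) v ≡ to φ v)
    every-automorphism-relabels φ =
        σ
      , λ v → vertex-ext {u = relabel σ v} {to φ v} λ i →
                trans (relabel-! σ v i) (sym (letterMap-spec φ v i))
      where
      σ : Permutation′ m
      σ = permutation (letterMap φ) (letterMap (inverse φ))
            (letterMap-cancel (inverse φ) φ (to∘from φ)) (letterMap-cancel φ (inverse φ) (from∘to φ))

mainTheorem11 : (n : ℕ) → 1 ≤ n → (Π : List (Permutation′ n)) →
    Admissible n Π → ShiftRestricted n Π →
    (m : ℕ) → n < m →
    AlphabetStable m Π → Subregular n Π →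
    AutIsoSym m Π
mainTheorem11 (suc k) (s≤s z≤n) Π _ _ m n<m stable subregular =
    relabelAut
  , relabel-homomorphism {Π = Π}
  , relabel-faithful {Π = Π} (<⇒≤ n<m)
  , every-automorphism-relabels (<⇒≤ n<m)
  where open Rigidity stable subregular
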